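{- For every $n\ge1$, $\mathrm{ex}_<(n,P_4^{132})=\mathrm{ex}_<(n,P_4^{213})=\left\lfloor \frac32(n-1)\right\rfloor$.
   Context: Edge-ordered graph: finite simple graph with a linear order on its edges; isomorphisms preserve order; subgraphs carry induced order; $\mathrm{ex}_<(n,H)$ is the maximum number of edges of an edge-ordered graph on $n$ vertices with no subgraph isomorphic to $H$. Notation: $P_k^{a_1a_2\dots a_{k-1}}$ denotes the path $v_1v_2\dots v_k$ in which edge $v_iv_{i+1}$ has label $a_i$, edges being ordered by label. So $P_4^{132}$ is $v_1v_2v_3v_4$ with $v_1v_2<v_3v_4<v_2v_3$, and $P_4^{213}$ has $v_2v_3<v_1v_2<v_3v_4$. -}

module Defs where

open import Data.Nat using (ℕ; zero; suc; _≤_)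
open import Data.Fin using (Fin; zero; suc) renaming (_<_ to _<ᶠ_)
open import Data.Product using (Σ; _×_; _,_; proj₁; proj₂)
open import Data.Sum using (_⊎_)
open import Data.List using (List; []; _∷_; length; lookup)
open import Data.List.Relation.Unary.All using (All; []; _∷_)
open import Data.List.Relation.Unary.AllPairs using ([]; _∷_)
open import Data.List.Relation.Unary.Unique.Propositional using (Unique)
open import Function.Definitions using (Injective)
open import Relation.Binary.PropositionalEquality using (_≡_; refl)
open import Relation.Nullary using (¬_)

-- Edges are stored as pairs (i , j) with i < j (so each unordered pair has
-- exactly one representation), without repetition; the linear order on the
-- edges is the order of the list (earlier = smaller).
record EOGraph (n : ℕ) : Set where
  field
    edges   : List (Fin n × Fin n)
    normal  : All (λ e → proj₁ e <ᶠ proj₂ e) edges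
    nodup   : Unique edges

open EOGraph public

∣E∣ : ∀ {n} → EOGraph n → ℕ
∣E∣ G = length (edges G)

Pos : ∀ {n} → EOGraph n → Set
Pos G = Fin (∣E∣ G)

EdgeAt : ∀ {n} (G : EOGraph n) → Pos G → Fin n → Fin n → Set
EdgeAt G p x y = (lookup (edges G) p ≡ (x , y)) ⊎ (lookup (edges G) p ≡ (y , x))

-- An order-preserving embedding of H into G: an injective vertex map φ and a
-- strictly increasing map ψ on edge positions such that the p-th edge {a,b}
-- of H is sent to the edge {φ a, φ b} of G sitting at position ψ p.
-- Equivalently, G has a subgraph (with the induced edge order) isomorphic to H.
record Embedding {k n : ℕ} (H : EOGraph k) (G : EOGraph n) : Set where
  field
    φ       : Fin k → Fin n
    φ-inj   : Injective _≡_ _≡_ φ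
    ψ       : Pos H → Pos G
    ψ-mono  : ∀ {p q} → p <ᶠ q → ψ p <ᶠ ψ q
    edge    : ∀ p → EdgeAt G (ψ p) (φ (proj₁ (lookup (edges H) p)))
                                   (φ (proj₂ (lookup (edges H) p)))

Contains : ∀ {n k} → EOGraph n → EOGraph k → Set
Contains G H = Embedding H G

IsEx : ∀ {k} → ℕ → EOGraph k → ℕ → Set
IsEx n H m =
  (Σ (EOGraph n) λ G → ¬ Contains G H × ∣E∣ G ≡ m)
  × (∀ (G : EOGraph n) → ¬ Contains G H → ∣E∣ G ≤ m)

private
  v1 v2 v3 v4 : Fin 4
  v1 = zero
  v2 = suc zero
  v3 = suc (suc zero)
  v4 = suc (suc (suc zero))

  open import Data.Nat using (z≤n; s≤s)

P4-132 : EOGraph 4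
P4-132 = record
  { edges  = (v1 , v2) ∷ (v3 , v4) ∷ (v2 , v3) ∷ []
  ; normal = s≤s z≤n ∷ s≤s (s≤s (s≤s z≤n)) ∷ s≤s (s≤s z≤n) ∷ []
  ; nodup  = ((λ ()) ∷ (λ ()) ∷ []) ∷ ((λ ()) ∷ []) ∷ [] ∷ []
  }

P4-213 : EOGraph 4
P4-213 = record
  { edges  = (v2 , v3) ∷ (v1 , v2) ∷ (v3 , v4) ∷ []
  ; normal = s≤s (s≤s z≤n) ∷ s≤s z≤n ∷ s≤s (s≤s (s≤s z≤n)) ∷ []
  ; nodup  = ((λ ()) ∷ (λ ()) ∷ []) ∷ ((λ ()) ∷ []) ∷ [] ∷ []
  }

-- Add the edges of a P4^{132}-free graph in increasing order. When uv arrives,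
-- u and v are not both covered by earlier edges with one of them covered twice: otherwise
-- some earlier neighbour w of u differs from an earlier neighbour z of v, and w u v z is a
-- path whose middle edge comes last, i.e. a P4^{132}. Giving a vertex of degree 0, 1, ≥ 2
-- the weight 3, 1, 0, each new edge therefore lowers the total weight by at least 2, and
-- the first two edges by 3 more; as the total starts at 3n, 2|E| + 3 ≤ 3n. Reversing the
-- edge order turns P4^{213} into P4^{132}, so the same bound holds for P4^{213}.
--
-- Order first the n - 1 spokes of a star and then a maximum matching on its
-- leaves. The last edge of a P4^{132} is its middle edge. If that is a spoke, so are the
-- other two, and three edges of a path share no vertex; otherwise both outer edges must be
-- spokes, since matching edges are disjoint, and the path would begin and end at the centre.
-- Reversing the order gives the extremal graph for P4^{213}.

module Submission where

open import Defs
open import Data.Nat using (ℕ; zero; suc; _+_; _*_; _∸_; _≤_; _<_; _≥_; z≤n; s≤s; s≤s⁻¹; ⌊_/2⌋)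
open import Data.Nat.Properties hiding (_≟_)
open import Data.Nat.DivMod using (_/_; m*n/n≡m; /-monoˡ-≤; m/n≡1+[m∸n]/n; +-distrib-/-∣ˡ)
open import Data.Nat.Divisibility using (n∣m*n)
open import Data.Nat.Solver using (module +-*-Solver)
open import Data.Fin as Fin using (Fin; zero; suc; toℕ; _↑ʳ_)
open import Data.Fin.Patterns using (0F; 1F; 2F)
open import Data.Fin.Properties as Finₚ using (toℕ-injective; toℕ<n; punchIn-punchOut; _≟_)
open import Data.Product as Product using (Σ-syntax; _×_; _,_; proj₁; proj₂)
open import Data.Sum as Sum using (_⊎_; inj₁; inj₂; [_,_])
open import Data.Empty using (⊥; ⊥-elim)
open import Data.List using (List; []; _∷_; _++_; _ʳ++_; reverse; map; tabulate; length; lookup)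
open import Data.List.Properties using (length-++; ++-identityʳ; ++-assoc; length-reverse; length-map; length-tabulate)
open import Data.List.Relation.Unary.All as All using (All; []; _∷_)
open import Data.List.Relation.Unary.All.Properties as All using ()
open import Data.List.Relation.Unary.AllPairs as AllPairs using (AllPairs; []; _∷_)
import Data.List.Relation.Unary.AllPairs.Properties as APP
open import Data.List.Relation.Unary.Unique.Propositional using (Unique)
import Data.List.Relation.Unary.Unique.Propositional.Properties as UP
open import Data.List.Membership.Propositional.Properties using (∈-lookup)
open import Data.List.Relation.Binary.Permutation.Propositional using (↭-sym; ↭⇒↭ₛ)
open import Data.List.Relation.Binary.Permutation.Propositional.Properties using (All-resp-↭; ↭-reverse)
import Data.List.Relation.Binary.Permutation.Setoid.Properties as Permutationₛ
open import Algebra.Properties.CommutativeMonoid.Sum +-0-commutativeMonoid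
  using (sum; sum-cong-≗; ∑-distrib-+; sum-remove)
open import Relation.Binary.PropositionalEquality
  using (_≡_; _≢_; refl; sym; trans; cong; cong₂; subst; subst₂; ≢-sym; setoid; module ≡-Reasoning)
open import Relation.Binary.Definitions using (Tri; tri<; tri≈; tri>)
open import Function using (_∘_)
open import Function.Definitions using (Injective)
open import Relation.Nullary using (¬_; Dec; yes; no)
open import Relation.Nullary.Decidable using (_⊎-dec_)

private
  variable
    n : ℕ

module _ {X : Set} where

  All⇒AllPairs : ∀ {P : X → Set} {R : X → X → Set} → (∀ {x y} → P x → P y → R x y) →
                 ∀ {xs} → All P xs → AllPairs R xs
  All⇒AllPairs R-of-P []         = []
  All⇒AllPairs R-of-P (px ∷ pxs) = All.map (R-of-P px) pxs ∷ All⇒AllPairs R-of-P pxs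

  allPairs-lookup : ∀ {R : X → X → Set} {xs : List X} → AllPairs R xs →
                    ∀ {i j} → i Fin.< j → R (lookup xs i) (lookup xs j)
  allPairs-lookup (x∼xs ∷ _)   {zero}  {suc j} _         = All.lookup x∼xs (∈-lookup j)
  allPairs-lookup (_ ∷ sorted) {suc i} {suc j} (s≤s i<j) = allPairs-lookup sorted i<j

  unique-lookup-injective : ∀ {xs : List X} → Unique xs → ∀ {i j} → lookup xs i ≡ lookup xs j → i ≡ j
  unique-lookup-injective unique {i} {j} eq with Finₚ.<-cmp i j
  ... | tri< i<j _ _ = ⊥-elim (allPairs-lookup unique i<j eq)
  ... | tri≈ _ i≡j _ = i≡j
  ... | tri> _ _ j<i = ⊥-elim (allPairs-lookup unique j<i (sym eq))

  unique-middle : ∀ (A : List X) {e B} → Unique (A ++ e ∷ B) → All (_≢ e) A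
  unique-middle []      _             = []
  unique-middle (a ∷ A) (a∉ ∷ unique) = All.head (All.++⁻ʳ A a∉) ∷ unique-middle A unique

  middle-index : ∀ {zs : List X} (xs : List X) {y ys} → zs ≡ xs ++ y ∷ ys →
                 Σ[ j ∈ Fin (length zs) ] toℕ j ≡ length xs × lookup zs j ≡ y
  middle-index []       refl = zero , refl , refl
  middle-index (x ∷ xs) refl = let j , j≡ , eq = middle-index xs refl in suc j , cong suc j≡ , eq

  prefix-index : ∀ {zs : List X} (xs : List X) {ys} → zs ≡ xs ++ ys → (i : Fin (length xs)) →
                 Σ[ j ∈ Fin (length zs) ] toℕ j ≡ toℕ i × lookup zs j ≡ lookup xs i
  prefix-index (x ∷ xs) refl zero    = zero , refl , refl
  prefix-index (x ∷ xs) refl (suc i) = let j , j≡ , eq = prefix-index xs refl i in suc j , cong suc j≡ , eq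

  lookup-ʳ++-shift : ∀ (xs zs : List X) (j : Fin (length (xs ʳ++ zs))) (k : Fin (length zs)) →
                     toℕ j ≡ length xs + toℕ k → lookup (xs ʳ++ zs) j ≡ lookup zs k
  lookup-ʳ++-shift []       zs j k j≡k = cong (lookup zs) (toℕ-injective j≡k)
  lookup-ʳ++-shift (x ∷ xs) zs j k j≡  = lookup-ʳ++-shift xs (x ∷ zs) j (suc k) (trans j≡ (sym (+-suc _ _)))

  lookup-ʳ++ : ∀ (xs ys : List X) (i : Fin (length xs)) (j : Fin (length (xs ʳ++ ys))) →
               suc (toℕ i + toℕ j) ≡ length xs → lookup (xs ʳ++ ys) j ≡ lookup xs i
  lookup-ʳ++ (x ∷ xs) ys zero    j i+j≡ = lookup-ʳ++-shift xs (x ∷ ys) j zero (trans (suc-injective i+j≡) (sym (+-identityʳ _)))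
  lookup-ʳ++ (x ∷ xs) ys (suc i) j i+j≡ = lookup-ʳ++ xs (x ∷ ys) i j (suc-injective i+j≡)

  mirror : (xs : List X) → Fin (length (reverse xs)) → Fin (length xs)
  mirror xs j = Fin.opposite (Fin.cast (length-reverse xs) j)

  mirror-sum : ∀ (xs : List X) j → suc (toℕ (mirror xs j) + toℕ j) ≡ length xs
  mirror-sum xs j = begin
    suc (toℕ (mirror xs j) + toℕ j)          ≡⟨ sym (+-suc _ (toℕ j)) ⟩
    toℕ (mirror xs j) + suc (toℕ j)          ≡⟨ cong (_+ suc (toℕ j)) (Finₚ.opposite-prop (Fin.cast _ j)) ⟩
    length xs ∸ suc (toℕ k) + suc (toℕ j)    ≡⟨ cong (λ t → length xs ∸ suc t + suc (toℕ j)) (Finₚ.toℕ-cast _ j) ⟩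
    length xs ∸ suc (toℕ j) + suc (toℕ j)    ≡⟨ m∸n+n≡m (subst (_≤ length xs) (cong suc (Finₚ.toℕ-cast _ j)) (toℕ<n k)) ⟩
    length xs                                ∎
    where
    open ≡-Reasoning
    k = Fin.cast (length-reverse xs) j

  lookup-mirror : ∀ (xs : List X) j → lookup xs (mirror xs j) ≡ lookup (reverse xs) j
  lookup-mirror xs j = sym (lookup-ʳ++ xs [] (mirror xs j) j (mirror-sum xs j))

  mirror-antitone : ∀ (xs : List X) {j j'} → j Fin.< j' → mirror xs j' Fin.< mirror xs j
  mirror-antitone xs {j} {j'} j<j' = +-cancelʳ-< (toℕ j) _ _ (begin-strict
    toℕ (mirror xs j') + toℕ j   <⟨ +-monoʳ-< (toℕ (mirror xs j')) j<j' ⟩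
    toℕ (mirror xs j') + toℕ j'  ≡⟨ suc-injective (trans (mirror-sum xs j') (sym (mirror-sum xs j))) ⟩
    toℕ (mirror xs j) + toℕ j    ∎)
    where open ≤-Reasoning

sum-const : ∀ n k → sum {n} (λ _ → k) ≡ n * k
sum-const zero    k = refl
sum-const (suc n) k = cong (k +_) (sum-const n k)

single≤sum : ∀ (f : Fin n → ℕ) i → f i ≤ sum f
single≤sum {suc n} f i = subst (f i ≤_) (sym (sum-remove {i = i} f)) (m≤m+n (f i) _)

pair≤sum : ∀ (f : Fin n → ℕ) {i j} → i ≢ j → f i + f j ≤ sum f
pair≤sum {suc n} f {i} {j} i≢j = begin
  f i + f j                                     ≡⟨ cong (λ k → f i + f k) (sym (punchIn-punchOut i≢j)) ⟩
  f i + f (Fin.punchIn i (Fin.punchOut i≢j))    ≤⟨ +-monoʳ-≤ (f i) (single≤sum (λ k → f (Fin.punchIn i k)) _) ⟩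
  f i + sum (λ k → f (Fin.punchIn i k))         ≡⟨ sym (sum-remove {i = i} f) ⟩
  sum f                                         ∎
  where open ≤-Reasoning

⌊n/2⌋≡n/2 : ∀ n → ⌊ n /2⌋ ≡ n / 2
⌊n/2⌋≡n/2 0             = refl
⌊n/2⌋≡n/2 1             = refl
⌊n/2⌋≡n/2 (suc (suc n)) = trans (cong suc (⌊n/2⌋≡n/2 n)) (sym (m/n≡1+[m∸n]/n {2 + n} (s≤s (s≤s z≤n))))

three-halves : ∀ m → 3 * m / 2 ≡ m + ⌊ m /2⌋
three-halves m = begin
  3 * m / 2               ≡⟨ cong (_/ 2) (solve 1 (λ m → con 3 :* m := m :* con 2 :+ m) refl m) ⟩
  (m * 2 + m) / 2         ≡⟨ +-distrib-/-∣ˡ m (n∣m*n m) ⟩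
  m * 2 / 2 + m / 2       ≡⟨ cong₂ _+_ (m*n/n≡m m 2) (sym (⌊n/2⌋≡n/2 m)) ⟩
  m + ⌊ m /2⌋             ∎
  where
  open ≡-Reasoning
  open +-*-Solver

Edge : ℕ → Set
Edge n = Fin n × Fin n

_∈ₑ_ : Fin n → Edge n → Set
x ∈ₑ e = x ≡ proj₁ e ⊎ x ≡ proj₂ e

_∈ₑ?_ : (x : Fin n) (e : Edge n) → Dec (x ∈ₑ e)
x ∈ₑ? e = (x ≟ proj₁ e) ⊎-dec (x ≟ proj₂ e)

Normal : Edge n → Set
Normal e = proj₁ e Fin.< proj₂ e

-- EdgeAt G p x y unfolds to Joins (lookup (edges G) p) x y.
Joins : Edge n → Fin n → Fin n → Set
Joins e x y = e ≡ (x , y) ⊎ e ≡ (y , x)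

Joins-sym : ∀ {e : Edge n} {x y} → Joins e x y → Joins e y x
Joins-sym (inj₁ eq) = inj₂ eq
Joins-sym (inj₂ eq) = inj₁ eq

Joins-∈ˡ : ∀ {e : Edge n} {x y} → Joins e x y → x ∈ₑ e
Joins-∈ˡ (inj₁ refl) = inj₁ refl
Joins-∈ˡ (inj₂ refl) = inj₂ refl

Joins-∈ʳ : ∀ {e : Edge n} {x y} → Joins e x y → y ∈ₑ e
Joins-∈ʳ = Joins-∈ˡ ∘ Joins-sym

Joins-∈⁻ : ∀ {e : Edge n} {x y z} → Joins e x y → z ∈ₑ e → z ≡ x ⊎ z ≡ y
Joins-∈⁻ (inj₁ refl) z∈ = z∈
Joins-∈⁻ (inj₂ refl) z∈ = Sum.swap z∈

∈ₑ⇒Joins : ∀ {e : Edge n} {x} → x ∈ₑ e → Σ[ y ∈ Fin n ] Joins e x y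
∈ₑ⇒Joins {e = a , b} (inj₁ refl) = b , inj₁ refl
∈ₑ⇒Joins {e = a , b} (inj₂ refl) = a , inj₂ refl

∈ₑ-both⇒Joins : ∀ {e : Edge n} {x y} → x ≢ y → x ∈ₑ e → y ∈ₑ e → Joins e x y
∈ₑ-both⇒Joins x≢y (inj₁ refl) (inj₁ refl) = ⊥-elim (x≢y refl)
∈ₑ-both⇒Joins x≢y (inj₁ refl) (inj₂ refl) = inj₁ refl
∈ₑ-both⇒Joins x≢y (inj₂ refl) (inj₁ refl) = inj₂ refl
∈ₑ-both⇒Joins x≢y (inj₂ refl) (inj₂ refl) = ⊥-elim (x≢y refl)

Joins-trans : ∀ {e : Edge n} {a b x y} → Joins e a b → Joins (a , b) x y → Joins e x y
Joins-trans ab (inj₁ refl) = ab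
Joins-trans ab (inj₂ refl) = Joins-sym ab

Normal-Joins-≢ : ∀ {e : Edge n} {x y} → Normal e → Joins e x y → x ≢ y
Normal-Joins-≢ x<y (inj₁ refl) refl = <-irrefl refl x<y
Normal-Joins-≢ y<x (inj₂ refl) refl = <-irrefl refl y<x

Normal-Joins-unique : ∀ {e e' : Edge n} {x y} → Normal e → Normal e' → Joins e x y → Joins e' x y → e ≡ e'
Normal-Joins-unique _ _ (inj₁ refl) (inj₁ refl) = refl
Normal-Joins-unique _ _ (inj₂ refl) (inj₂ refl) = refl
Normal-Joins-unique x<y y<x (inj₁ refl) (inj₂ refl) = ⊥-elim (<-asym x<y y<x)
Normal-Joins-unique y<x x<y (inj₂ refl) (inj₁ refl) = ⊥-elim (<-asym x<y y<x)

mapEdge : ∀ {m} → (Fin m → Fin n) → Edge m → Edge n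
mapEdge f = Product.map f f

Joins-map : ∀ {m} (f : Fin m → Fin n) {e x y} → Joins e x y → Joins (mapEdge f e) (f x) (f y)
Joins-map f = Sum.map (cong (mapEdge f)) (cong (mapEdge f))

∈ₑ-mapEdge⁻ : ∀ {m} {f : Fin m → Fin n} → Injective _≡_ _≡_ f → ∀ {e x} → f x ∈ₑ mapEdge f e → x ∈ₑ e
∈ₑ-mapEdge⁻ f-inj = Sum.map f-inj f-inj

Disjointₑ : Edge n → Edge n → Set
Disjointₑ e e' = ∀ {x} → x ∈ₑ e → x ∈ₑ e' → ⊥

Disjointₑ⇒≢ : ∀ {e e' : Edge n} → Disjointₑ e e' → e ≢ e'
Disjointₑ⇒≢ disjoint refl = disjoint (inj₁ refl) (inj₁ refl)

mapEdge-disjoint : ∀ {m} {f : Fin m → Fin n} → Injective _≡_ _≡_ f →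
                   ∀ {e e'} → Disjointₑ e e' → Disjointₑ (mapEdge f e) (mapEdge f e')
mapEdge-disjoint f-inj disjoint (inj₁ refl) x∈e' = disjoint (inj₁ refl) (∈ₑ-mapEdge⁻ f-inj x∈e')
mapEdge-disjoint f-inj disjoint (inj₂ refl) x∈e' = disjoint (inj₂ refl) (∈ₑ-mapEdge⁻ f-inj x∈e')

mapEdge-injective : ∀ {m} {f : Fin m → Fin n} → Injective _≡_ _≡_ f →
                    ∀ {e e'} → mapEdge f e ≡ mapEdge f e' → e ≡ e'
mapEdge-injective f-inj eq = cong₂ _,_ (f-inj (cong proj₁ eq)) (f-inj (cong proj₂ eq))

-- The potential argument

degree : List (Edge n) → Fin n → ℕ
degree []      x = 0
degree (e ∷ A) x with x ∈ₑ? e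
... | yes _ = suc (degree A x)
... | no  _ = degree A x

degree-++-∈ : ∀ (A : List (Edge n)) {e x} → x ∈ₑ e → degree (A ++ e ∷ []) x ≡ suc (degree A x)
degree-++-∈ [] {e} {x} x∈e with x ∈ₑ? e
... | yes _   = refl
... | no  x∉e = ⊥-elim (x∉e x∈e)
degree-++-∈ (a ∷ A) {x = x} x∈e with x ∈ₑ? a
... | yes _ = cong suc (degree-++-∈ A x∈e)
... | no  _ = degree-++-∈ A x∈e

degree-++-∉ : ∀ (A : List (Edge n)) {e x} → ¬ x ∈ₑ e → degree (A ++ e ∷ []) x ≡ degree A x
degree-++-∉ [] {e} {x} x∉e with x ∈ₑ? e
... | yes x∈e = ⊥-elim (x∉e x∈e)
... | no  _   = refl
degree-++-∉ (a ∷ A) {x = x} x∉e with x ∈ₑ? a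
... | yes _ = cong suc (degree-++-∉ A x∉e)
... | no  _ = degree-++-∉ A x∉e

degree-single-≤1 : ∀ (a : Edge n) x → degree (a ∷ []) x ≤ 1
degree-single-≤1 a x with x ∈ₑ? a
... | yes _ = ≤-refl
... | no  _ = z≤n

degree-witness : ∀ (A : List (Edge n)) {x} → 1 ≤ degree A x → Σ[ i ∈ Fin (length A) ] x ∈ₑ lookup A i
degree-witness (a ∷ A) {x} 1≤d with x ∈ₑ? a
... | yes x∈a = zero , x∈a
... | no  _   = let i , x∈ = degree-witness A 1≤d in suc i , x∈

degree-witness₂ : ∀ (A : List (Edge n)) {x} → 2 ≤ degree A x →
                  Σ[ i ∈ Fin (length A) ] Σ[ j ∈ Fin (length A) ] i ≢ j × x ∈ₑ lookup A i × x ∈ₑ lookup A j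
degree-witness₂ (a ∷ A) {x} 2≤d with x ∈ₑ? a
... | yes x∈a = let j , x∈ = degree-witness A (s≤s⁻¹ 2≤d) in zero , suc j , (λ ()) , x∈a , x∈
... | no  _   = let i , j , i≢j , x∈i , x∈j = degree-witness₂ A 2≤d
                in suc i , suc j , (λ eq → i≢j (Finₚ.suc-injective eq)) , x∈i , x∈j

Fork : List (Edge n) → Fin n → Fin n → Set
Fork A x y = 2 ≤ degree A x × 1 ≤ degree A y

ClosesFork : List (Edge n) → Edge n → Set
ClosesFork A (u , v) = Fork A u v ⊎ Fork A v u

weight : ℕ → ℕ
weight 0 = 3
weight 1 = 1
weight _ = 0

decrease : ℕ → ℕ
decrease d = weight d ∸ weight (suc d)

weight-suc : ∀ d → weight (suc d) + decrease d ≡ weight d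
weight-suc d = m+[n∸m]≡n (weight-suc-≤ d)
  where
  weight-suc-≤ : ∀ d → weight (suc d) ≤ weight d
  weight-suc-≤ 0       = s≤s z≤n
  weight-suc-≤ 1       = z≤n
  weight-suc-≤ (suc (suc d)) = z≤n

decrease-≥2 : ∀ d₁ d₂ → ¬ (2 ≤ d₁ × 1 ≤ d₂) → ¬ (2 ≤ d₂ × 1 ≤ d₁) → 2 ≤ decrease d₁ + decrease d₂
decrease-≥2 0             d₂            _ _ = m≤m+n 2 _
decrease-≥2 (suc d₁)      0             _ _ = m≤n+m 2 _
decrease-≥2 1             1             _ _ = ≤-refl
decrease-≥2 (suc (suc _)) (suc _)       f _ = ⊥-elim (f (s≤s (s≤s z≤n) , s≤s z≤n))
decrease-≥2 1             (suc (suc _)) _ f = ⊥-elim (f (s≤s (s≤s z≤n) , s≤s z≤n))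

decrease-≥3 : ∀ d₁ d₂ → d₁ ≤ 1 → d₂ ≤ 1 → ¬ (1 ≤ d₁ × 1 ≤ d₂) → 3 ≤ decrease d₁ + decrease d₂
decrease-≥3 0 0 _ _ _ = s≤s (s≤s (s≤s z≤n))
decrease-≥3 0 1 _ _ _ = ≤-refl
decrease-≥3 1 0 _ _ _ = ≤-refl
decrease-≥3 1 1 _ _ f = ⊥-elim (f (≤-refl , ≤-refl))
decrease-≥3 (suc (suc _)) _ (s≤s ()) _ _
decrease-≥3 _ (suc (suc _)) _ (s≤s ()) _

totalWeight : List (Edge n) → ℕ
totalWeight A = sum (λ x → weight (degree A x))

lostWeight : List (Edge n) → Edge n → Fin n → ℕ
lostWeight A e x = weight (degree A x) ∸ weight (degree (A ++ e ∷ []) x)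

weight-++ : ∀ (A : List (Edge n)) e x → weight (degree A x) ≡ weight (degree (A ++ e ∷ []) x) + lostWeight A e x
weight-++ A e x with x ∈ₑ? e
... | yes x∈e rewrite degree-++-∈ A x∈e = sym (weight-suc (degree A x))
... | no  x∉e rewrite degree-++-∉ A x∉e | n∸n≡0 (weight (degree A x)) = sym (+-identityʳ _)

lostWeight-endpoint : ∀ (A : List (Edge n)) {e x} → x ∈ₑ e → lostWeight A e x ≡ decrease (degree A x)
lostWeight-endpoint A x∈e rewrite degree-++-∈ A x∈e = refl

totalWeight-++ : ∀ (A : List (Edge n)) e → totalWeight A ≡ totalWeight (A ++ e ∷ []) + sum (lostWeight A e)
totalWeight-++ {n} A e = trans (sum-cong-≗ {n} (weight-++ A e)) (∑-distrib-+ _ (lostWeight A e))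

totalWeight-drop : ∀ (A : List (Edge n)) {e} → Normal e →
                   totalWeight (A ++ e ∷ []) + (decrease (degree A (proj₁ e)) + decrease (degree A (proj₂ e))) ≤ totalWeight A
totalWeight-drop A {e@(u , v)} u<v = begin
  totalWeight (A ++ e ∷ []) + (decrease (degree A u) + decrease (degree A v))
    ≡⟨ cong (totalWeight (A ++ e ∷ []) +_) (sym (cong₂ _+_ (lostWeight-endpoint A (inj₁ refl)) (lostWeight-endpoint A (inj₂ refl)))) ⟩
  totalWeight (A ++ e ∷ []) + (lostWeight A e u + lostWeight A e v)
    ≤⟨ +-monoʳ-≤ (totalWeight (A ++ e ∷ [])) (pair≤sum (lostWeight A e) (λ u≡v → <-irrefl (cong toℕ u≡v) u<v)) ⟩
  totalWeight (A ++ e ∷ []) + sum (lostWeight A e)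
    ≡⟨ sym (totalWeight-++ A e) ⟩
  totalWeight A ∎
  where open ≤-Reasoning

-- The first edge lowers totalWeight by 4 and the second by at least 3, which is 2 and 1
-- more than the 2 per edge paid for by 2 * length A in the potential.
bonus : ∀ {X : Set} → List X → ℕ
bonus []          = 0
bonus (_ ∷ [])    = 2
bonus (_ ∷ _ ∷ _) = 3

Extends : List (Edge n) → Edge n → Set
Extends A e = Normal e × All Normal A × All (_≢ e) A × ¬ ClosesFork A e

bonus-step : ∀ (A : List (Edge n)) {e} → Extends A e →
             2 + bonus (A ++ e ∷ []) ≤ bonus A + (decrease (degree A (proj₁ e)) + decrease (degree A (proj₂ e)))
bonus-step []            _ = ≤-refl
bonus-step (a ∷ [])      {u , v} (u<v , a-normal ∷ [] , a≢e ∷ [] , _) =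
  +-monoʳ-≤ 2 (decrease-≥3 _ _ (degree-single-≤1 a u) (degree-single-≤1 a v) not-both)
  where
  not-both : ¬ (1 ≤ degree (a ∷ []) u × 1 ≤ degree (a ∷ []) v)
  not-both (du , dv) with degree-witness (a ∷ []) du | degree-witness (a ∷ []) dv
  ... | zero , u∈a | zero , v∈a =
    a≢e (Normal-Joins-unique a-normal u<v (∈ₑ-both⇒Joins (<⇒≢ u<v ∘ cong toℕ) u∈a v∈a) (inj₁ refl))
bonus-step (_ ∷ _ ∷ _)   (_ , _ , _ , ¬fork) = +-monoʳ-≤ 3 (decrease-≥2 _ _ (¬fork ∘ inj₁) (¬fork ∘ inj₂))

potential : List (Edge n) → ℕ
potential A = 2 * length A + bonus A + totalWeight A

potential-step : ∀ (A : List (Edge n)) {e} → Extends A e → potential (A ++ e ∷ []) ≤ potential A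
potential-step A {e@(u , v)} ext@(u<v , _) = begin
  2 * length (A ++ e ∷ []) + bonus (A ++ e ∷ []) + totalWeight (A ++ e ∷ [])
    ≡⟨ cong (λ l → 2 * l + bonus (A ++ e ∷ []) + totalWeight (A ++ e ∷ [])) (length-++ A) ⟩
  2 * (length A + 1) + bonus (A ++ e ∷ []) + totalWeight (A ++ e ∷ [])
    ≡⟨ solve 3 (λ l b f → con 2 :* (l :+ con 1) :+ b :+ f := con 2 :* l :+ (con 2 :+ b) :+ f) refl (length A) _ _ ⟩
  2 * length A + (2 + bonus (A ++ e ∷ [])) + totalWeight (A ++ e ∷ [])
    ≤⟨ +-monoˡ-≤ _ (+-monoʳ-≤ (2 * length A) (bonus-step A ext)) ⟩
  2 * length A + (bonus A + s) + totalWeight (A ++ e ∷ [])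
    ≡⟨ solve 4 (λ l b s f → l :+ (b :+ s) :+ f := l :+ b :+ (f :+ s)) refl (2 * length A) (bonus A) s _ ⟩
  2 * length A + bonus A + (totalWeight (A ++ e ∷ []) + s)
    ≤⟨ +-monoʳ-≤ (2 * length A + bonus A) (totalWeight-drop A u<v) ⟩
  potential A ∎
  where
  open ≤-Reasoning
  open +-*-Solver
  s = decrease (degree A u) + decrease (degree A v)

potential-bound : ∀ (L : List (Edge n)) → (∀ A e B → L ≡ A ++ e ∷ B → Extends A e) → potential L ≤ 3 * n
potential-bound {n} L extends = go [] L refl (≤-reflexive (trans (sum-const n 3) (*-comm n 3)))
  where
  go : ∀ A B → L ≡ A ++ B → potential A ≤ 3 * n → potential L ≤ 3 * n
  go A []      L≡A   bound = subst (λ X → potential X ≤ 3 * n) (sym (trans L≡A (++-identityʳ A))) bound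
  go A (e ∷ B) L≡AeB bound =
    go (A ++ e ∷ []) B (trans L≡AeB (sym (++-assoc A (e ∷ []) B)))
       (≤-trans (potential-step A (extends A e B L≡AeB)) bound)

length-bound : ∀ {X : Set} (L : List X) → 2 * length L + bonus L ≤ 3 * n → length L ≤ 3 * (n ∸ 1) / 2
length-bound {n} L bound = begin
  length L              ≡⟨ sym (m*n/n≡m (length L) 2) ⟩
  length L * 2 / 2      ≤⟨ /-monoˡ-≤ 2 (subst (_≤ 3 * (n ∸ 1)) (*-comm 2 (length L)) (double-bound {n} L bound)) ⟩
  3 * (n ∸ 1) / 2       ∎
  where
  open ≤-Reasoning
  double-bound : ∀ {n} {X : Set} (L : List X) → 2 * length L + bonus L ≤ 3 * n → 2 * length L ≤ 3 * (n ∸ 1)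
  double-bound []              _ = z≤n
  double-bound {suc (suc n)} (_ ∷ []) _ = ≤-trans (n≤1+n 2) (*-monoʳ-≤ 3 (s≤s (z≤n {n})))
  double-bound {1}           (_ ∷ []) (s≤s (s≤s (s≤s ())))
  double-bound {n} L@(_ ∷ _ ∷ _) bound =
    subst (2 * length L ≤_) (sym (*-distribˡ-∸ 3 n 1)) (m+n≤o⇒m≤o∸n _ bound)

ForkFree : List (Edge n) → Set
ForkFree L = ∀ A e B → L ≡ A ++ e ∷ B → ¬ ClosesFork A e

forkFree-length-bound : ∀ (L : List (Edge n)) → All Normal L → Unique L → ForkFree L → length L ≤ 3 * (n ∸ 1) / 2
forkFree-length-bound {n} L normal unique forkFree =
  length-bound {n} L (≤-trans (m≤m+n _ (totalWeight L)) (potential-bound L extends))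
  where
  extends : ∀ A e B → L ≡ A ++ e ∷ B → Extends A e
  extends A e B L≡AeB =
    All.head (All.++⁻ʳ A normal′) , All.++⁻ˡ A normal′ , unique-middle A (subst Unique L≡AeB unique) , forkFree A e B L≡AeB
    where normal′ = subst (All Normal) L≡AeB normal

-- Forks in P4^{132}-free graphs

module _ {n} (G : EOGraph n) where

  private
    E : Pos G → Edge n
    E = lookup (edges G)

  edge-normal : ∀ p → Normal (E p)
  edge-normal p = All.lookup (normal G) (∈-lookup p)

  EdgeAt-≢ : ∀ {p x y} → EdgeAt G p x y → x ≢ y
  EdgeAt-≢ {p} = Normal-Joins-≢ (edge-normal p)

  EdgeAt-unique : ∀ {p q x y} → EdgeAt G p x y → EdgeAt G q x y → p ≡ q
  EdgeAt-unique {p} {q} at-p at-q =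
    unique-lookup-injective (nodup G) (Normal-Joins-unique (edge-normal p) (edge-normal q) at-p at-q)

  P4-132-embedding : ∀ {x₁ x₂ x₃ x₄ r₁ r₂ r₃} → Unique (x₁ ∷ x₂ ∷ x₃ ∷ x₄ ∷ []) →
                     AllPairs Fin._<_ (r₁ ∷ r₂ ∷ r₃ ∷ []) →
                     EdgeAt G r₁ x₁ x₂ → EdgeAt G r₂ x₃ x₄ → EdgeAt G r₃ x₂ x₃ → Contains G P4-132
  P4-132-embedding distinct sorted e₁ e₂ e₃ = record
    { φ      = lookup (_ ∷ _ ∷ _ ∷ _ ∷ [])
    ; φ-inj  = unique-lookup-injective distinct
    ; ψ      = lookup (_ ∷ _ ∷ _ ∷ [])
    ; ψ-mono = allPairs-lookup sorted
    ; edge   = λ { 0F → e₁ ; 1F → e₂ ; 2F → e₃ }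
    }

  path-contains-P4-132 : ∀ {p p' q w u v z} → p Fin.< q → p' Fin.< q →
                         EdgeAt G p w u → EdgeAt G q u v → EdgeAt G p' v z → w ≢ z → Contains G P4-132
  path-contains-P4-132 {p} {p'} {q} {w} {u} {v} {z} p<q p'<q wu uv vz w≢z = by-order (Finₚ.<-cmp p p')
    where
    w≢u = EdgeAt-≢ wu
    u≢v = EdgeAt-≢ uv
    v≢z = EdgeAt-≢ vz
    w≢v : w ≢ v
    w≢v refl = <-irrefl (cong toℕ (EdgeAt-unique wu (Joins-sym uv))) p<q
    u≢z : u ≢ z
    u≢z refl = <-irrefl (cong toℕ (EdgeAt-unique vz (Joins-sym uv))) p'<q

    by-order : Tri (p Fin.< p') (p ≡ p') (p' Fin.< p) → Contains G P4-132
    by-order (tri< p<p' _ _) = P4-132-embedding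
      ((w≢u ∷ w≢v ∷ w≢z ∷ []) ∷ (u≢v ∷ u≢z ∷ []) ∷ (v≢z ∷ []) ∷ [] ∷ [])
      ((p<p' ∷ p<q ∷ []) ∷ (p'<q ∷ []) ∷ [] ∷ []) wu vz uv
    by-order (tri> _ _ p'<p) = P4-132-embedding  -- the path read backwards: z v u w
      ((≢-sym v≢z ∷ ≢-sym u≢z ∷ ≢-sym w≢z ∷ []) ∷ (≢-sym u≢v ∷ ≢-sym w≢v ∷ []) ∷ (≢-sym w≢u ∷ []) ∷ [] ∷ [])
      ((p'<p ∷ p'<q ∷ []) ∷ (p<q ∷ []) ∷ [] ∷ []) (Joins-sym vz) (Joins-sym wu) (Joins-sym uv)
    by-order (tri≈ _ p≡p' _) =
      ⊥-elim ([ w≢v ∘ sym , u≢v ∘ sym ] (Joins-∈⁻ wu (Joins-∈ˡ (subst (λ r → EdgeAt G r v z) (sym p≡p') vz))))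

  fork-contains-P4-132 : ∀ {p₁ p₂ p₃ q u v w₁ w₂ z} → EdgeAt G q u v → p₁ ≢ p₂ →
                         p₁ Fin.< q → p₂ Fin.< q → p₃ Fin.< q →
                         EdgeAt G p₁ u w₁ → EdgeAt G p₂ u w₂ → EdgeAt G p₃ v z → Contains G P4-132
  fork-contains-P4-132 {w₁ = w₁} {w₂} {z} uv p₁≢p₂ p₁<q p₂<q p₃<q uw₁ uw₂ vz with w₁ ≟ z
  ... | no  w₁≢z = path-contains-P4-132 p₁<q p₃<q (Joins-sym uw₁) uv vz w₁≢z
  ... | yes w₁≡z = path-contains-P4-132 p₂<q p₃<q (Joins-sym uw₂) uv vz w₂≢z
    where
    w₂≢z : w₂ ≢ z
    w₂≢z w₂≡z = p₁≢p₂ (EdgeAt-unique uw₁ (subst (EdgeAt G _ _) (trans w₂≡z (sym w₁≡z)) uw₂))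

  module _ {A e B} (split : edges G ≡ A ++ e ∷ B) where

    split-position : Pos G
    split-position = proj₁ (middle-index A split)

    split-position-toℕ : toℕ split-position ≡ length A
    split-position-toℕ = proj₁ (proj₂ (middle-index A split))

    split-edge : lookup (edges G) split-position ≡ e
    split-edge = proj₂ (proj₂ (middle-index A split))

    prefix-position : Fin (length A) → Pos G
    prefix-position i = proj₁ (prefix-index A split i)

    prefix-position-toℕ : ∀ i → toℕ (prefix-position i) ≡ toℕ i
    prefix-position-toℕ i = proj₁ (proj₂ (prefix-index A split i))

    prefix-position-< : ∀ i → prefix-position i Fin.< split-position
    prefix-position-< i =
      subst₂ _<_ (sym (prefix-position-toℕ i)) (sym split-position-toℕ) (toℕ<n i)

    prefix-position-edge : ∀ {i x} → x ∈ₑ lookup A i → Σ[ w ∈ Fin n ] EdgeAt G (prefix-position i) x w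
    prefix-position-edge {i} x∈ =
      let w , joins = ∈ₑ⇒Joins x∈
      in w , subst (λ e′ → Joins e′ _ w) (sym (proj₂ (proj₂ (prefix-index A split i)))) joins

    split-fork-contains-P4-132 : ∀ {x y} → EdgeAt G split-position x y → Fork A x y → Contains G P4-132
    split-fork-contains-P4-132 xy (2≤dx , 1≤dy) with degree-witness₂ A 2≤dx | degree-witness A 1≤dy
    ... | i , j , i≢j , x∈i , x∈j | k , y∈k =
      fork-contains-P4-132 xy (i≢j ∘ position-injective)
        (prefix-position-< i) (prefix-position-< j) (prefix-position-< k)
        (proj₂ (prefix-position-edge x∈i)) (proj₂ (prefix-position-edge x∈j)) (proj₂ (prefix-position-edge y∈k))
      where
      position-injective : prefix-position i ≡ prefix-position j → i ≡ j
      position-injective eq =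
        toℕ-injective (trans (sym (prefix-position-toℕ i)) (trans (cong toℕ eq) (prefix-position-toℕ j)))

  P4-132-free⇒forkFree : ¬ Contains G P4-132 → ForkFree (edges G)
  P4-132-free⇒forkFree free A e B split (inj₁ fork) =
    free (split-fork-contains-P4-132 split (inj₁ (split-edge split)) fork)
  P4-132-free⇒forkFree free A e B split (inj₂ fork) =
    free (split-fork-contains-P4-132 split (inj₂ (split-edge split)) fork)

P4-132-free-bound : ∀ (G : EOGraph n) → ¬ Contains G P4-132 → ∣E∣ G ≤ 3 * (n ∸ 1) / 2
P4-132-free-bound G free = forkFree-length-bound (edges G) (normal G) (nodup G) (P4-132-free⇒forkFree G free)

-- Reversing the edge order

reverseOrder : EOGraph n → EOGraph n
reverseOrder G = record
  { edges  = reverse (edges G)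
  ; normal = All-resp-↭ (↭-sym (↭-reverse (edges G))) (normal G)
  ; nodup  = Permutationₛ.Unique-resp-↭ (setoid _) (↭⇒↭ₛ (↭-sym (↭-reverse (edges G)))) (nodup G)
  }

reverse-embedding : ∀ {k k'} {H : EOGraph k} {H' : EOGraph k'} {G : EOGraph n} →
                    Embedding H (reverseOrder G) → Embedding H' (reverseOrder H) → Contains G H'
reverse-embedding {H = H} {H'} {G} H↪G H'↪H = record
  { φ      = H↪G.φ ∘ H'↪H.φ
  ; φ-inj  = H'↪H.φ-inj ∘ H↪G.φ-inj
  ; ψ      = ψ
  ; ψ-mono = λ p<q → mirror-antitone (edges G) (H↪G.ψ-mono (mirror-antitone (edges H) (H'↪H.ψ-mono p<q)))
  ; edge   = edge
  }
  where
  module H↪G = Embedding H↪G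
  module H'↪H = Embedding H'↪H

  ψ : Pos H' → Pos G
  ψ = mirror (edges G) ∘ H↪G.ψ ∘ mirror (edges H) ∘ H'↪H.ψ

  edge : ∀ p → EdgeAt G (ψ p) (H↪G.φ (H'↪H.φ (proj₁ (lookup (edges H') p)))) (H↪G.φ (H'↪H.φ (proj₂ (lookup (edges H') p))))
  edge p = subst (λ e → Joins e _ _) (sym (lookup-mirror (edges G) _))
    (Joins-trans (H↪G.edge i)
      (Joins-map H↪G.φ (subst (λ e → Joins e _ _) (sym (lookup-mirror (edges H) _)) (H'↪H.edge p))))
    where i = mirror (edges H) (H'↪H.ψ p)

opposite-injective : ∀ {k} {i j : Fin k} → Fin.opposite i ≡ Fin.opposite j → i ≡ j
opposite-injective {i = i} {j} eq =
  trans (sym (Finₚ.opposite-involutive i)) (trans (cong Fin.opposite eq) (Finₚ.opposite-involutive j))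

-- Read backwards, P4^{132} with its edge order reversed is P4^{213}, and vice versa.
P4-213↪reverse-P4-132 : Embedding P4-213 (reverseOrder P4-132)
P4-213↪reverse-P4-132 = record
  { φ = Fin.opposite ; φ-inj = opposite-injective ; ψ = λ p → p ; ψ-mono = λ p<q → p<q
  ; edge = λ { 0F → inj₂ refl ; 1F → inj₂ refl ; 2F → inj₂ refl } }

P4-132↪reverse-P4-213 : Embedding P4-132 (reverseOrder P4-213)
P4-132↪reverse-P4-213 = record
  { φ = Fin.opposite ; φ-inj = opposite-injective ; ψ = λ p → p ; ψ-mono = λ p<q → p<q
  ; edge = λ { 0F → inj₂ refl ; 1F → inj₂ refl ; 2F → inj₂ refl } }

reverse-P4-132-free : ∀ {G : EOGraph n} → ¬ Contains G P4-213 → ¬ Contains (reverseOrder G) P4-132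
reverse-P4-132-free free P4-132↪ = free (reverse-embedding P4-132↪ P4-213↪reverse-P4-132)

reverse-P4-213-free : ∀ {G : EOGraph n} → ¬ Contains G P4-132 → ¬ Contains (reverseOrder G) P4-213
reverse-P4-213-free free P4-213↪ = free (reverse-embedding P4-213↪ P4-132↪reverse-P4-213)

P4-213-free-bound : ∀ (G : EOGraph n) → ¬ Contains G P4-213 → ∣E∣ G ≤ 3 * (n ∸ 1) / 2
P4-213-free-bound G free =
  subst (_≤ _) (length-reverse (edges G)) (P4-132-free-bound (reverseOrder G) (reverse-P4-132-free free))

-- The extremal graphs

module _ {n} (G : EOGraph n) (c : Fin n) {S R : List (Edge n)} (edges≡ : edges G ≡ S ++ R)
         (S∋c : All (c ∈ₑ_) S) (R∌c : All (λ e → ¬ c ∈ₑ e) R) (R-disjoint : AllPairs Disjointₑ R) where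

  private
    E : Pos G → Edge n
    E = lookup (edges G)

    SpokeBefore RimDisjoint : Edge n → Edge n → Set
    SpokeBefore e e' = c ∈ₑ e' → c ∈ₑ e
    RimDisjoint e e' = ¬ c ∈ₑ e → ¬ c ∈ₑ e' → Disjointₑ e e'

    spokes-before : AllPairs SpokeBefore (S ++ R)
    spokes-before = APP.++⁺ (All⇒AllPairs (λ c∈e _ _ → c∈e) S∋c)
                            (All⇒AllPairs (λ _ c∉e' c∈e' → ⊥-elim (c∉e' c∈e')) R∌c)
                            (All.map (λ c∈e → All.map (λ _ _ → c∈e) R∌c) S∋c)

    rims-disjoint : AllPairs RimDisjoint (S ++ R)
    rims-disjoint = APP.++⁺ (All⇒AllPairs (λ c∈e _ c∉e → ⊥-elim (c∉e c∈e)) S∋c)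
                            (AllPairs.map (λ disjoint _ _ → disjoint) R-disjoint)
                            (All.map (λ c∈e → All.map (λ _ c∉e → ⊥-elim (c∉e c∈e)) R∌c) S∋c)

    spokes-first : ∀ {p q} → p Fin.< q → c ∈ₑ E q → c ∈ₑ E p
    spokes-first = allPairs-lookup (subst (AllPairs SpokeBefore) (sym edges≡) spokes-before)

    rim-edges-disjoint : ∀ {p q} → p Fin.< q → ¬ c ∈ₑ E p → ¬ c ∈ₑ E q → Disjointₑ (E p) (E q)
    rim-edges-disjoint = allPairs-lookup (subst (AllPairs RimDisjoint) (sym edges≡) rims-disjoint)

    rim-neighbour : ∀ {p q x y} → p Fin.< q → Joins (E p) x y → y ∈ₑ E q → ¬ c ∈ₑ E q → c ≡ x
    rim-neighbour {p} p<q xy y∈q c∉q with c ∈ₑ? E p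
    ... | yes c∈p = [ (λ c≡x → c≡x) , (λ c≡y → ⊥-elim (c∉q (subst (_∈ₑ _) (sym c≡y) y∈q))) ] (Joins-∈⁻ xy c∈p)
    ... | no  c∉p = ⊥-elim (rim-edges-disjoint p<q c∉p c∉q (Joins-∈ʳ xy) y∈q)

  star-rim-P4-132-free : ¬ Contains G P4-132
  star-rim-P4-132-free P4-132↪G = by-middle (c ∈ₑ? E (ψ 2F))
    where
    open Embedding P4-132↪G

    distinct : ∀ {i j} → i ≢ j → φ i ≢ φ j
    distinct i≢j = i≢j ∘ φ-inj

    centre-on-middle : c ∈ₑ E (ψ 2F) → ⊥
    centre-on-middle c∈mid
      with Joins-∈⁻ (edge 2F) c∈mid
         | Joins-∈⁻ (edge 0F) (spokes-first (ψ-mono (s≤s z≤n)) c∈mid)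
         | Joins-∈⁻ (edge 1F) (spokes-first (ψ-mono (s≤s (s≤s z≤n))) c∈mid)
    ... | inj₁ c≡x₂ | _         | inj₁ c≡x₃ = distinct (λ ()) (trans (sym c≡x₂) c≡x₃)
    ... | inj₁ c≡x₂ | _         | inj₂ c≡x₄ = distinct (λ ()) (trans (sym c≡x₂) c≡x₄)
    ... | inj₂ c≡x₃ | inj₁ c≡x₁ | _         = distinct (λ ()) (trans (sym c≡x₃) c≡x₁)
    ... | inj₂ c≡x₃ | inj₂ c≡x₂ | _         = distinct (λ ()) (trans (sym c≡x₃) c≡x₂)

    by-middle : Dec (c ∈ₑ E (ψ 2F)) → ⊥
    by-middle (yes c∈mid) = centre-on-middle c∈mid
    by-middle (no  c∉mid) = distinct (λ ()) (trans (sym c≡x₁) c≡x₄)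
      where
      c≡x₁ = rim-neighbour (ψ-mono (s≤s z≤n)) (edge 0F) (Joins-∈ˡ (edge 2F)) c∉mid
      c≡x₄ = rim-neighbour (ψ-mono (s≤s (s≤s z≤n))) (Joins-sym (edge 1F)) (Joins-∈ʳ (edge 2F)) c∉mid

matching : ∀ k → List (Edge k)
matching 0               = []
matching 1               = []
matching (suc (suc k))   = (0F , 1F) ∷ map (mapEdge (2 ↑ʳ_)) (matching k)

matching-length : ∀ k → length (matching k) ≡ ⌊ k /2⌋
matching-length 0             = refl
matching-length 1             = refl
matching-length (suc (suc k)) = cong suc (trans (length-map _ (matching k)) (matching-length k))

matching-normal : ∀ k → All Normal (matching k)
matching-normal 0             = []
matching-normal 1             = []
matching-normal (suc (suc k)) = s≤s z≤n ∷ All.map⁺ (All.map (λ a<b → s≤s (s≤s a<b)) (matching-normal k))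

matching-disjoint : ∀ k → AllPairs Disjointₑ (matching k)
matching-disjoint 0             = []
matching-disjoint 1             = []
matching-disjoint (suc (suc k)) =
  All.map⁺ (All.universal first-pair-disjoint (matching k))
  ∷ APP.map⁺ (AllPairs.map (mapEdge-disjoint (Finₚ.↑ʳ-injective 2 _ _)) (matching-disjoint k))
  where
  first-pair-disjoint : ∀ e → Disjointₑ (0F , 1F) (mapEdge (2 ↑ʳ_) e)
  first-pair-disjoint _ (inj₁ refl) (inj₁ ())
  first-pair-disjoint _ (inj₁ refl) (inj₂ ())
  first-pair-disjoint _ (inj₂ refl) (inj₁ ())
  first-pair-disjoint _ (inj₂ refl) (inj₂ ())

module _ (m : ℕ) where

  spokes : List (Edge (suc m))
  spokes = tabulate (λ i → 0F , suc i)

  rim : List (Edge (suc m))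
  rim = map (mapEdge suc) (matching m)

  spokes∋centre : All (0F ∈ₑ_) spokes
  spokes∋centre = All.tabulate⁺ (λ _ → inj₁ refl)

  rim∌centre : All (λ e → ¬ 0F ∈ₑ e) rim
  rim∌centre = All.map⁺ (All.universal (λ _ → λ { (inj₁ ()) ; (inj₂ ()) }) (matching m))

  rim-disjoint : AllPairs Disjointₑ rim
  rim-disjoint = APP.map⁺ (AllPairs.map (mapEdge-disjoint Finₚ.suc-injective) (matching-disjoint m))

  spokes-unique : Unique spokes
  spokes-unique = UP.tabulate⁺ (λ eq → Finₚ.suc-injective (cong proj₂ eq))

  rim-unique : Unique rim
  rim-unique = UP.map⁺ (mapEdge-injective Finₚ.suc-injective) (AllPairs.map Disjointₑ⇒≢ (matching-disjoint m))

  spokes≢rim : All (λ s → All (s ≢_) rim) spokes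
  spokes≢rim = All.map (λ 0∈s → All.map (λ 0∉r s≡r → 0∉r (subst (0F ∈ₑ_) s≡r 0∈s)) rim∌centre) spokes∋centre

  star-matching : EOGraph (suc m)
  star-matching = record
    { edges  = spokes ++ rim
    ; normal = All.++⁺ (All.tabulate⁺ (λ _ → s≤s z≤n)) (All.map⁺ (All.map s≤s (matching-normal m)))
    ; nodup  = APP.++⁺ spokes-unique rim-unique spokes≢rim
    }

  star-matching-P4-132-free : ¬ Contains star-matching P4-132
  star-matching-P4-132-free = star-rim-P4-132-free star-matching 0F refl spokes∋centre rim∌centre rim-disjoint

  star-matching-size : ∣E∣ star-matching ≡ 3 * m / 2
  star-matching-size = begin
    length (spokes ++ rim)             ≡⟨ length-++ spokes ⟩
    length spokes + length rim         ≡⟨ cong₂ _+_ (length-tabulate _) (trans (length-map _ (matching m)) (matching-length m)) ⟩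
    m + ⌊ m /2⌋                        ≡⟨ sym (three-halves m) ⟩
    3 * m / 2                          ∎
    where open ≡-Reasoning

theorem4p6 : ∀ (n : ℕ) → n ≥ 1 →
    IsEx n P4-132 ((3 * (n ∸ 1)) / 2) × IsEx n P4-213 ((3 * (n ∸ 1)) / 2)
theorem4p6 (suc m) _ =
    ((star-matching m , star-matching-P4-132-free m , star-matching-size m) , P4-132-free-bound)
  , ((reverseOrder (star-matching m) , reverse-P4-213-free (star-matching-P4-132-free m)
     , trans (length-reverse (edges (star-matching m))) (star-matching-size m)) , P4-213-free-bound)
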